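{- Let $N\ge 1$ be an integer and $G$ a connected graph (possibly empty). For the game $CSG(I_N)$ with $I_N=\{1,\ldots,N\}$: $\mathcal{G}_{I_N}(G)=|G|$ if $|G|\in\{0,1\}$; $\mathcal{G}_{I_N}(G)\ge 2$ if $|G|\in\{2,\ldots,N\}$; $\mathcal{G}_{I_N}(G)=0$ if $|G|=N+1$; and $\mathcal{G}_{I_N}(G)=1$ if $|G|=N+2$.
   Context: For a set $L$ of positive integers, the game $CSG(L)$ on a connected graph $G$ is the two-player impartial game in which a move consists in removing from the current graph a connected subgraph $H$ such that $|V(H)|\in L$ and the remaining graph is connected (the empty graph counts as connected, so removing the whole graph is allowed when its size is in $L$). The player unable to move loses. $\mathcal{G}_L(G)$ denotes the Grundy value of $CSG(L)$ on $G$. $|G|$ denotes the number of vertices of $G$. -}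

module Defs where

open import Data.Bool using (Bool; true; false; T; _∧_; if_then_else_)
open import Data.Nat using (ℕ; zero; suc; _≤_; _≤ᵇ_)
open import Data.Fin using (Fin)
open import Data.Fin.Subset using (Subset; inside; outside; _∈_; _⊆_; _─_; ∣_∣)
open import Data.Fin.Subset.Properties using (_∈?_; _⊆?_)
open import Data.Fin.Properties using (any?; all?)
open import Data.List using (List; []; _∷_; [_]; map; _++_; filter; length)
open import Data.List.Membership.DecPropositional using ()
open import Data.Product using (Σ; ∃; _×_; _,_)
open import Data.Sum using (_⊎_)
open import Relation.Binary.PropositionalEquality using (_≡_)
open import Relation.Nullary using (Dec; yes; no; ¬_; does)
open import Relation.Nullary.Decidable using (_×-dec_; _⊎-dec_; _→-dec_)
import Data.Nat.Properties as ℕP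
open import Data.Vec using ([]; _∷_)

record Graph (n : ℕ) : Set where
  field
    adj     : Fin n → Fin n → Bool
    symm    : ∀ u v → adj u v ≡ adj v u
    irrefl  : ∀ u → adj u u ≡ false
open Graph public

module _ {n : ℕ} (G : Graph n) where

  Reach : ℕ → Subset n → Fin n → Fin n → Set
  Reach zero    S u v = u ≡ v
  Reach (suc k) S u v =
    Reach k S u v ⊎ ∃ λ w → (w ∈ S) × Reach k S u w × T (adj G w v)

  reach? : ∀ k S u v → Dec (Reach k S u v)
  reach? zero    S u v = u Data.Fin.≟ v
  reach? (suc k) S u v =
    reach? k S u v ⊎-dec any? (λ w → (w ∈? S) ×-dec (reach? k S u w ×-dec T? (adj G w v)))
    where
      T? : ∀ b → Dec (T b)
      T? true  = yes _
      T? false = no λ ()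

  -- The subgraph of G induced by the vertex set S is connected:
  -- any two of its vertices are joined by a path inside S
  -- (a path has at most n-1 edges; the empty graph is connected).
  Connected : Subset n → Set
  Connected S = ∀ u v → u ∈ S → v ∈ S → Reach n S u v

  connected? : ∀ S → Dec (Connected S)
  connected? S = all? (λ u → all? (λ v → (u ∈? S) →-dec ((v ∈? S) →-dec reach? n S u v)))

allSubsets : ∀ n → List (Subset n)
allSubsets zero    = [ [] ]
allSubsets (suc n) = map (inside ∷_) (allSubsets n) ++ map (outside ∷_) (allSubsets n)

-- A set L of positive integers, given by its (decidable) characteristic function.
module _ {n : ℕ} (L : ℕ → Bool) (G : Graph n) where

  LegalRemoval : Subset n → Subset n → Set
  LegalRemoval S X = X ⊆ S × T (L ∣ X ∣) × Connected G X × Connected G (S ─ X)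

  legalRemoval? : ∀ S X → Dec (LegalRemoval S X)
  legalRemoval? S X = (X ⊆? S) ×-dec (T? (L ∣ X ∣) ×-dec (connected? G X ×-dec connected? G (S ─ X)))
    where
      T? : ∀ b → Dec (T b)
      T? true  = yes _
      T? false = no λ ()

  options : Subset n → List (Subset n)
  options S = map (S ─_) (filter (legalRemoval? S) (allSubsets n))

mexAux : ℕ → ℕ → List ℕ → ℕ
mexAux k zero    l = k
mexAux k (suc f) l =
  if does (Data.List.Membership.DecPropositional._∈?_ ℕP._≟_ k l)
  then mexAux (suc k) f l else k

mex : List ℕ → ℕ
mex l = mexAux 0 (suc (length l)) l

-- Grundy value with fuel. Since every element of L is positive, each move
-- removes at least one vertex, so fuel ∣ S ∣ suffices.
grundyF : {n : ℕ} (L : ℕ → Bool) (G : Graph n) → ℕ → Subset n → ℕ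
grundyF L G zero    S = 0
grundyF L G (suc f) S = mex (map (grundyF L G f) (options L G S))

-- 𝒢_L of the graph G[S] (the subgraph of G induced by S).
grundy : {n : ℕ} (L : ℕ → Bool) (G : Graph n) → Subset n → ℕ
grundy L G S = grundyF L G ∣ S ∣ S

I : ℕ → ℕ → Bool
I N k = (1 ≤ᵇ k) ∧ (k ≤ᵇ N)

-- Every legal move removes between 1 and N vertices.  A graph with 1 to N
-- vertices can be removed entirely, so 0 is an option value and 𝒢 ≥ 1; with
-- N + 1 vertices every move leaves 1 to N vertices, hence 𝒢 = 0.  The larger
-- cases rest on the fact that a connected graph with at least two vertices has
-- a non-cut vertex v (a vertex farthest from some fixed vertex): for
-- 2 ≤ |G| ≤ N, removing G - v leaves the single vertex v, of value 1, so
-- 𝒢 ≥ 2; for |G| = N + 2, removing v leaves N + 1 vertices, of value 0, while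
-- every move leaves 2 to N + 1 vertices, of value ≥ 2 or 0, so 𝒢 = 1.
module Submission where

open import Defs
open import Data.Bool using (Bool; true; T)
open import Data.Bool.Properties using (T-∧)
open import Data.Fin using (Fin; _≟_)
open import Data.Fin.Subset
  using (Subset; inside; outside; _∈_; _∉_; _⊆_; _⊂_; _─_; _-_; ∣_∣; ⁅_⁆; ⊤; Nonempty)
open import Data.Fin.Subset.Properties
  using ( _∈?_; nonempty?; Empty-unique; drop-∷-⊆; ∣⊥∣≡0; ∣⊤∣≡n; ∣p∣≤n; ∣⁅x⁆∣≡1
        ; x∈⁅y⁆⇒x≡y; x∈p∧x≢y⇒x∈p-y; p─q⊆p; x∉⁅y⁆⇒x≢y
        ; p⊂q⇒∣p∣<∣q∣; x∈p⇒∣p-x∣<∣p∣)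
open import Data.Fin.Properties using (any?)
open import Data.List using (List; []; _∷_; map; filter; length)
open import Data.List.Properties using (map-cong-local)
open import Data.List.Relation.Unary.Any using (here; there)
import Data.List.Relation.Unary.All as All
open import Data.List.Membership.Propositional using ()
  renaming (_∈_ to _∈ₗ_; _∉_ to _∉ₗ_)
open import Data.List.Membership.Propositional.Properties
  using (∈-map⁺; ∈-map⁻; ∈-filter⁺; ∈-filter⁻; ∈-++⁺ˡ; ∈-++⁺ʳ)
import Data.Nat.Properties as ℕ
open import Data.List.Membership.DecPropositional ℕ._≟_ using ()
  renaming (_∈?_ to _∈ₗ?_)
open import Data.Nat using (ℕ; zero; suc; _≤_; _<_; _+_; z≤n; s≤s; s≤s⁻¹)
open import Data.Nat.Properties
  using ( ≤-refl; ≤-trans; ≤-reflexive; n≤1+n; ≤-<-trans; <⇒≤; <⇒≱; ≤∧≢⇒<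
        ; <-≤-trans; n≤0⇒n≡0; m<m+n
        ; +-suc; +-comm; +-cancelʳ-≡; +-cancelʳ-≤; +-monoʳ-≤; ≤ᵇ⇒≤; ≤⇒≤ᵇ)
open import Data.Vec using (tabulate; []; _∷_; here; there)
open import Data.Vec.Properties using (lookup∘tabulate; lookup⇒[]=; []=⇒lookup)
open import Data.Product using (∃; _×_; _,_; proj₁; proj₂)
open import Data.Sum using (_⊎_; inj₁; inj₂)
open import Function using (_∘_; id)
open import Function.Bundles using (Equivalence)
open import Relation.Nullary using (yes; no; ¬_; does; contradiction)
open import Relation.Nullary.Decidable using (_×-dec_; ¬?; dec-true; dec-false; decidable-stable)
open import Relation.Binary.PropositionalEquality
  using (_≡_; _≢_; refl; sym; trans; cong; subst)

k≤mexAux : ∀ k f l → k ≤ mexAux k f l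
k≤mexAux k zero    l = ≤-refl
k≤mexAux k (suc f) l with k ∈ₗ? l
... | yes _ = ≤-trans (n≤1+n k) (k≤mexAux (suc k) f l)
... | no  _ = ≤-refl

mexAux-∈ : ∀ {k f l} → k ∈ₗ l → mexAux k (suc f) l ≡ mexAux (suc k) f l
mexAux-∈ {k} {f} {l} k∈ with k ∈ₗ? l
... | yes _  = refl
... | no k∉ = contradiction k∈ k∉

mexAux-∉ : ∀ {k f l} → k ∉ₗ l → mexAux k (suc f) l ≡ k
mexAux-∉ {k} {f} {l} k∉ with k ∈ₗ? l
... | yes k∈ = contradiction k∈ k∉
... | no  _  = refl

0∉⇒mex≡0 : ∀ {l} → 0 ∉ₗ l → mex l ≡ 0
0∉⇒mex≡0 {l} = mexAux-∉ {f = length l}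

0∈⇒1≤mex : ∀ {l} → 0 ∈ₗ l → 1 ≤ mex l
0∈⇒1≤mex {l} 0∈ = subst (1 ≤_) (sym (mexAux-∈ {f = length l} 0∈)) (k≤mexAux 1 (length l) l)

0∈∧1∉⇒mex≡1 : ∀ {l} → 0 ∈ₗ l → 1 ∉ₗ l → mex l ≡ 1
0∈∧1∉⇒mex≡1 {_ ∷ xs} 0∈ 1∉ = trans (mexAux-∈ {f = suc (length xs)} 0∈) (mexAux-∉ {f = length xs} 1∉)

0∈∧1∈⇒2≤mex : ∀ {l} → 0 ∈ₗ l → 1 ∈ₗ l → 2 ≤ mex l
0∈∧1∈⇒2≤mex {l@(_ ∷ xs)} 0∈ 1∈ =
  subst (2 ≤_) (sym (trans (mexAux-∈ {f = suc (length xs)} 0∈) (mexAux-∈ {f = length xs} 1∈)))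
        (k≤mexAux 2 (length xs) l)

x∈p─q⇒x∉q : ∀ {n} {x : Fin n} (p q : Subset n) → x ∈ p ─ q → x ∉ q
x∈p─q⇒x∉q (inside ∷ p)  (inside ∷ q) () here
x∈p─q⇒x∉q (outside ∷ p) (inside ∷ q) () here
x∈p─q⇒x∉q (_ ∷ p)       (_ ∷ q)      (there x∈) (there x∈q) = x∈p─q⇒x∉q p q x∈ x∈q

∣p─q∣+∣q∣≡∣p∣ : ∀ {n} (p q : Subset n) → q ⊆ p → ∣ p ─ q ∣ + ∣ q ∣ ≡ ∣ p ∣
∣p─q∣+∣q∣≡∣p∣ []            []            _   = refl
∣p─q∣+∣q∣≡∣p∣ (inside ∷ p)  (inside ∷ q)  q⊆p = trans (+-suc _ _) (cong suc (∣p─q∣+∣q∣≡∣p∣ p q (drop-∷-⊆ q⊆p)))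
∣p─q∣+∣q∣≡∣p∣ (outside ∷ p) (inside ∷ q)  q⊆p with q⊆p here
... | ()
∣p─q∣+∣q∣≡∣p∣ (inside ∷ p)  (outside ∷ q) q⊆p = cong suc (∣p─q∣+∣q∣≡∣p∣ p q (drop-∷-⊆ q⊆p))
∣p─q∣+∣q∣≡∣p∣ (outside ∷ p) (outside ∷ q) q⊆p = ∣p─q∣+∣q∣≡∣p∣ p q (drop-∷-⊆ q⊆p)

x∈p⇒⁅x⁆⊆p : ∀ {n} {x : Fin n} {p : Subset n} → x ∈ p → ⁅ x ⁆ ⊆ p
x∈p⇒⁅x⁆⊆p {x = x} {p} x∈p y∈ = subst (_∈ p) (sym (x∈⁅y⁆⇒x≡y x y∈)) x∈p

∣p-x∣+1≡∣p∣ : ∀ {n} {x : Fin n} {p : Subset n} → x ∈ p → ∣ p - x ∣ + 1 ≡ ∣ p ∣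
∣p-x∣+1≡∣p∣ {x = x} {p} x∈p =
  trans (cong (∣ p - x ∣ +_) (sym (∣⁅x⁆∣≡1 x))) (∣p─q∣+∣q∣≡∣p∣ p ⁅ x ⁆ (x∈p⇒⁅x⁆⊆p x∈p))

1≤∣p∣⇒Nonempty : ∀ {n} {p : Subset n} → 1 ≤ ∣ p ∣ → Nonempty p
1≤∣p∣⇒Nonempty {n} {p} 1≤∣p∣ with nonempty? p
... | yes ne = ne
... | no ¬ne = contradiction (subst (1 ≤_) (trans (cong ∣_∣ (Empty-unique ¬ne)) (∣⊥∣≡0 n)) 1≤∣p∣) λ ()

module _ {n : ℕ} (G : Graph n) where

  Reach-mono : ∀ {S u v j k} → j ≤ k → Reach G j S u v → Reach G k S u v
  Reach-mono {j = zero}  {zero}  z≤n       r = r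
  Reach-mono {j = zero}  {suc k} z≤n       r = inj₁ (Reach-mono z≤n r)
  Reach-mono {j = suc j} {suc k} (s≤s j≤k) (inj₁ r) = inj₁ (Reach-mono j≤k r)
  Reach-mono {j = suc j} {suc k} (s≤s j≤k) (inj₂ (w , w∈ , r , e)) = inj₂ (w , w∈ , Reach-mono j≤k r , e)

  Reach-refl : ∀ {S u} k → Reach G k S u u
  Reach-refl k = Reach-mono z≤n refl

  Reach-cons : ∀ {S a x b} k → a ∈ S → T (adj G a x) → Reach G k S x b → Reach G (suc k) S a b
  Reach-cons zero    a∈ e refl     = inj₂ (_ , a∈ , refl , e)
  Reach-cons (suc k) a∈ e (inj₁ r) = inj₁ (Reach-cons k a∈ e r)
  Reach-cons (suc k) a∈ e (inj₂ (w , w∈ , r , e′)) = inj₂ (w , w∈ , Reach-cons k a∈ e r , e′)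

  Reach-sym : ∀ {S a b} k → a ∈ S → b ∈ S → Reach G k S a b → Reach G k S b a
  Reach-sym zero    _  _  refl     = refl
  Reach-sym (suc k) a∈ b∈ (inj₁ r) = inj₁ (Reach-sym k a∈ b∈ r)
  Reach-sym {b = b} (suc k) a∈ b∈ (inj₂ (w , w∈ , r , e)) =
    Reach-cons k b∈ (subst T (symm G w b) e) (Reach-sym k a∈ w∈ r)

  Reach-trans : ∀ {S a b c} j k → Reach G j S a b → Reach G k S b c → Reach G (j + k) S a c
  Reach-trans zero    k refl     r′ = r′
  Reach-trans (suc j) k (inj₁ r) r′ = Reach-mono (n≤1+n _) (Reach-trans j k r r′)
  Reach-trans {S} {a} {c = c} (suc j) k (inj₂ (w , w∈ , r , e)) r′ =
    subst (λ m → Reach G m S a c) (+-suc j k) (Reach-trans j (suc k) r (Reach-cons k w∈ e r′))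

  -- The balls around a grow strictly until they stop growing, and there is
  -- room for at most n of them.
  module _ (S : Subset n) (a : Fin n) where

    ball : ℕ → Subset n
    ball k = tabulate (λ x → does (reach? G k S a x))

    ∈ball⁺ : ∀ {k x} → Reach G k S a x → x ∈ ball k
    ∈ball⁺ {k} {x} r = lookup⇒[]= x (ball k) (trans (lookup∘tabulate _ x) (dec-true (reach? G k S a x) r))

    ∈ball⁻ : ∀ {k x} → x ∈ ball k → Reach G k S a x
    ∈ball⁻ {k} {x} x∈ = decidable-stable (reach? G k S a x) λ ¬r →
      contradiction (trans (sym does≡true) (dec-false (reach? G k S a x) ¬r)) λ ()
      where
      does≡true : does (reach? G k S a x) ≡ true
      does≡true = trans (sym (lookup∘tabulate _ x)) ([]=⇒lookup x∈)

    Saturated : ℕ → Set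
    Saturated k = ∀ x → Reach G (suc k) S a x → Reach G k S a x

    saturated⇒Reach-bounded : ∀ {k x} → Saturated k → ∀ m → Reach G m S a x → Reach G k S a x
    saturated⇒Reach-bounded sat zero    r        = Reach-mono z≤n r
    saturated⇒Reach-bounded sat (suc m) (inj₁ r) = saturated⇒Reach-bounded sat m r
    saturated⇒Reach-bounded sat (suc m) (inj₂ (w , w∈ , r , e)) =
      sat _ (inj₂ (w , w∈ , saturated⇒Reach-bounded sat m r , e))

    saturated⊎ball⊂ : ∀ k → Saturated k ⊎ ball k ⊂ ball (suc k)
    saturated⊎ball⊂ k with any? (λ x → reach? G (suc k) S a x ×-dec ¬? (reach? G k S a x))
    ... | yes (x , r , ¬r) = inj₂ ((∈ball⁺ ∘ inj₁ ∘ ∈ball⁻) , x , ∈ball⁺ r , ¬r ∘ ∈ball⁻)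
    ... | no ¬new = inj₁ λ x r → decidable-stable (reach? G k S a x) λ ¬r → ¬new (x , r , ¬r)

    saturated⊎<∣ball∣ : ∀ j → (∃ λ i → i ≤ j × Saturated i) ⊎ j < ∣ ball j ∣
    saturated⊎<∣ball∣ zero = inj₂ (≤-<-trans z≤n (x∈p⇒∣p-x∣<∣p∣ (∈ball⁺ {0} refl)))
    saturated⊎<∣ball∣ (suc j) with saturated⊎<∣ball∣ j | saturated⊎ball⊂ j
    ... | inj₁ (i , i≤j , sat) | _        = inj₁ (i , ≤-trans i≤j (n≤1+n j) , sat)
    ... | inj₂ _               | inj₁ sat = inj₁ (j , n≤1+n j , sat)
    ... | inj₂ j<∣b∣           | inj₂ b⊂b′ = inj₂ (≤-trans (s≤s j<∣b∣) (p⊂q⇒∣p∣<∣q∣ b⊂b′))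

  Reach-shorten : ∀ {S a b} m → Reach G m S a b → Reach G n S a b
  Reach-shorten {S} {a} m r with saturated⊎<∣ball∣ S a n
  ... | inj₁ (i , i≤n , sat) = Reach-mono i≤n (saturated⇒Reach-bounded S a sat m r)
  ... | inj₂ n<∣b∣           = contradiction (∣p∣≤n (ball S a n)) (<⇒≱ n<∣b∣)

  Subsingleton⇒Connected : ∀ {S v} → (∀ x → x ∈ S → x ≡ v) → Connected G S
  Subsingleton⇒Connected {S} all≡v a b a∈ b∈ =
    subst (Reach G n S a) (trans (all≡v a a∈) (sym (all≡v b b∈))) (Reach-refl n)

  -- Only the last vertex of a walk needs to lie in S, and a walk of length at
  -- most j + 1 can meet v only there.
  Reach-avoid : ∀ {S u v x} j → ¬ Reach G j S u v → Reach G (suc j) S u x → Reach G (suc j) (S - v) u x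
  Reach-avoid zero ¬r (inj₁ refl) = inj₁ refl
  Reach-avoid zero ¬r (inj₂ (w , w∈ , refl , e)) = inj₂ (w , x∈p∧x≢y⇒x∈p-y w∈ ¬r , refl , e)
  Reach-avoid (suc j) ¬r (inj₁ r) = inj₁ (Reach-avoid j (¬r ∘ inj₁) r)
  Reach-avoid (suc j) ¬r (inj₂ (w , w∈ , r , e)) =
    inj₂ (w , x∈p∧x≢y⇒x∈p-y w∈ (λ { refl → ¬r r }) , Reach-avoid j (¬r ∘ inj₁) r , e)

  farthest-vertex : ∀ {S u w} m → w ∈ S → w ≢ u → (∀ x → x ∈ S → Reach G m S u x) →
    ∃ λ k → ∃ λ v → v ∈ S × ¬ Reach G k S u v × (∀ x → x ∈ S → Reach G (suc k) S u x)
  farthest-vertex zero w∈ w≢u reach = contradiction (sym (reach _ w∈)) w≢u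
  farthest-vertex {S} {u} (suc m) w∈ w≢u reach
    with any? (λ x → (x ∈? S) ×-dec ¬? (reach? G m S u x))
  ... | yes (v , v∈ , ¬r) = m , v , v∈ , ¬r , reach
  ... | no ¬far = farthest-vertex m w∈ w≢u λ x x∈ →
    decidable-stable (reach? G m S u x) λ ¬r → ¬far (x , x∈ , ¬r)

  beyond-ball⇒non-cut : ∀ {S u v} k → u ∈ S → ¬ Reach G k S u v →
    (∀ x → x ∈ S → Reach G (suc k) S u x) → Connected G (S - v)
  beyond-ball⇒non-cut {S} {u} {v} k u∈ ¬u↝v u↝ a b a∈ b∈ = Reach-shorten (suc k + suc k)
    (Reach-trans (suc k) (suc k) (Reach-sym (suc k) u∈′ a∈ (u↝′ a a∈)) (u↝′ b b∈))
    where
    u∈′ : u ∈ S - v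
    u∈′ = x∈p∧x≢y⇒x∈p-y u∈ λ u≡v → ¬u↝v (subst (Reach G k S u) u≡v (Reach-refl k))
    u↝′ : ∀ x → x ∈ S - v → Reach G (suc k) (S - v) u x
    u↝′ x x∈ = Reach-avoid k ¬u↝v (u↝ x (p─q⊆p S ⁅ v ⁆ x∈))

  non-cut-vertex : ∀ {S} → Connected G S → 2 ≤ ∣ S ∣ → ∃ λ v → v ∈ S × Connected G (S - v)
  non-cut-vertex {S} conn 2≤∣S∣ with 1≤∣p∣⇒Nonempty (≤-trans (n≤1+n 1) 2≤∣S∣)
  ... | u , u∈ with 1≤∣p∣⇒Nonempty {p = S - u} (+-cancelʳ-≤ 1 1 _ (subst (2 ≤_) (sym (∣p-x∣+1≡∣p∣ u∈)) 2≤∣S∣))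
  ...   | w , w∈S-u with farthest-vertex n (p─q⊆p S ⁅ u ⁆ w∈S-u) (x∉⁅y⁆⇒x≢y (x∈p─q⇒x∉q S ⁅ u ⁆ w∈S-u))
                                        (λ x → conn u x u∈)
  ...     | k , v , v∈ , ¬u↝v , u↝ = v , v∈ , beyond-ball⇒non-cut k u∈ ¬u↝v u↝

∈allSubsets : ∀ {n} (X : Subset n) → X ∈ₗ allSubsets n
∈allSubsets []                    = here refl
∈allSubsets {suc n} (inside ∷ X)  = ∈-++⁺ˡ (∈-map⁺ (inside ∷_) (∈allSubsets X))
∈allSubsets {suc n} (outside ∷ X) = ∈-++⁺ʳ (map (inside ∷_) (allSubsets n)) (∈-map⁺ (outside ∷_) (∈allSubsets X))

module _ {n : ℕ} (L : ℕ → Bool) (G : Graph n) where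

  ∈-options⁺ : ∀ {S X} → LegalRemoval L G S X → S ─ X ∈ₗ options L G S
  ∈-options⁺ {S} {X} legal = ∈-map⁺ (S ─_) (∈-filter⁺ (legalRemoval? L G S) (∈allSubsets X) legal)

  ∈-options⁻ : ∀ {S o} → o ∈ₗ options L G S → ∃ λ X → LegalRemoval L G S X × o ≡ S ─ X
  ∈-options⁻ {S} o∈ with ∈-map⁻ (S ─_) o∈
  ... | X , X∈ , o≡ = X , proj₂ (∈-filter⁻ (legalRemoval? L G S) {xs = allSubsets n} X∈) , o≡

  optionValues : Subset n → List ℕ
  optionValues S = map (grundy L G) (options L G S)

  ∈-optionValues⁺ : ∀ {S X} → LegalRemoval L G S X → grundy L G (S ─ X) ∈ₗ optionValues S
  ∈-optionValues⁺ = ∈-map⁺ (grundy L G) ∘ ∈-options⁺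

  ∈-optionValues⁻ : ∀ {S x} → x ∈ₗ optionValues S →
    ∃ λ X → LegalRemoval L G S X × x ≡ grundy L G (S ─ X)
  ∈-optionValues⁻ {S} x∈ with ∈-map⁻ (grundy L G) x∈
  ... | o , o∈ , x≡ with ∈-options⁻ o∈
  ...   | X , legal , refl = X , legal , x≡

  grundy-empty : ∀ S → ∣ S ∣ ≡ 0 → grundy L G S ≡ 0
  grundy-empty S ∣S∣≡0 = cong (λ f → grundyF L G f S) ∣S∣≡0

  module _ (L-positive : ∀ k → T (L k) → 1 ≤ k) where

    options-smaller : ∀ {S o} → o ∈ₗ options L G S → ∣ o ∣ < ∣ S ∣
    options-smaller {S} o∈ with ∈-options⁻ o∈
    ... | X , (X⊆S , X∈L , _) , refl =
      subst (∣ S ─ X ∣ <_) (∣p─q∣+∣q∣≡∣p∣ S X X⊆S) (m<m+n _ (L-positive _ X∈L))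

    options-empty : ∀ S → ∣ S ∣ ≡ 0 → options L G S ≡ []
    options-empty S ∣S∣≡0 with options L G S | options-smaller {S}
    ... | []    | _       = refl
    ... | o ∷ _ | smaller = contradiction (subst (∣ o ∣ <_) ∣S∣≡0 (smaller (here refl))) λ ()

    -- Each move shrinks the position, so fuel beyond ∣ S ∣ is never consumed.
    grundyF-fuel : ∀ S f f′ → ∣ S ∣ ≤ f → ∣ S ∣ ≤ f′ → grundyF L G f S ≡ grundyF L G f′ S
    grundyF-fuel S zero    zero     _    _     = refl
    grundyF-fuel S zero    (suc f′) ∣S∣≤0 _   =
      cong (mex ∘ map (grundyF L G f′)) (sym (options-empty S (n≤0⇒n≡0 ∣S∣≤0)))
    grundyF-fuel S (suc f) zero     _    ∣S∣≤0 =
      cong (mex ∘ map (grundyF L G f)) (options-empty S (n≤0⇒n≡0 ∣S∣≤0))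
    grundyF-fuel S (suc f) (suc f′) ∣S∣≤f ∣S∣≤f′ =
      cong mex (map-cong-local {xs = options L G S} (All.tabulate λ {o} o∈ →
        grundyF-fuel o f f′ (s≤s⁻¹ (<-≤-trans (options-smaller {S} o∈) ∣S∣≤f))
                            (s≤s⁻¹ (<-≤-trans (options-smaller {S} o∈) ∣S∣≤f′))))

    grundy-mex : ∀ S → grundy L G S ≡ mex (optionValues S)
    grundy-mex S = trans (grundyF-fuel S ∣ S ∣ (suc ∣ S ∣) ≤-refl (n≤1+n _))
      (cong mex (map-cong-local {xs = options L G S} (All.tabulate λ {o} o∈ →
        grundyF-fuel o ∣ S ∣ ∣ o ∣ (<⇒≤ (options-smaller {S} o∈)) ≤-refl)))

T-I⁺ : ∀ {N k} → 1 ≤ k → k ≤ N → T (I N k)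
T-I⁺ 1≤k k≤N = Equivalence.from T-∧ (≤⇒≤ᵇ 1≤k , ≤⇒≤ᵇ k≤N)

T-I⁻ : ∀ {N k} → T (I N k) → 1 ≤ k × k ≤ N
T-I⁻ {N} {k} t with Equivalence.to T-∧ t
... | 1≤ᵇk , k≤ᵇN = ≤ᵇ⇒≤ 1 k 1≤ᵇk , ≤ᵇ⇒≤ k N k≤ᵇN

I-positive : ∀ N k → T (I N k) → 1 ≤ k
I-positive N k = proj₁ ∘ T-I⁻

module _ (N : ℕ) {n : ℕ} (G : Graph n) where

  𝒢 : Subset n → ℕ
  𝒢 = grundy (I N) G

  𝒢-mex : ∀ S → 𝒢 S ≡ mex (optionValues (I N) G S)
  𝒢-mex = grundy-mex (I N) G (I-positive N)

  remaining-size : ∀ {S X d} → LegalRemoval (I N) G S X → ∣ S ∣ ≡ d + N →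
    d ≤ ∣ S ─ X ∣ × ∣ S ─ X ∣ < d + N
  remaining-size {S} {X} {d} (X⊆S , X∈I , _) ∣S∣≡d+N with T-I⁻ X∈I
  ... | 1≤∣X∣ , ∣X∣≤N =
    +-cancelʳ-≤ N d _ (subst (_≤ ∣ S ─ X ∣ + N) size (+-monoʳ-≤ ∣ S ─ X ∣ ∣X∣≤N)) ,
    subst (∣ S ─ X ∣ <_) size (m<m+n _ 1≤∣X∣)
    where
    size : ∣ S ─ X ∣ + ∣ X ∣ ≡ d + N
    size = trans (∣p─q∣+∣q∣≡∣p∣ S X X⊆S) ∣S∣≡d+N

  0∈optionValues : ∀ S → Connected G S → 1 ≤ ∣ S ∣ → ∣ S ∣ ≤ N → 0 ∈ₗ optionValues (I N) G S
  0∈optionValues S conn 1≤∣S∣ ∣S∣≤N =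
    subst (_∈ₗ optionValues (I N) G S) (grundy-empty (I N) G (S ─ S) ∣S─S∣≡0)
      (∈-optionValues⁺ (I N) G removeAll)
    where
    removeAll : LegalRemoval (I N) G S S
    removeAll = id , T-I⁺ 1≤∣S∣ ∣S∣≤N , conn ,
      λ u _ u∈ _ → contradiction (p─q⊆p S S u∈) (x∈p─q⇒x∉q S S u∈)
    ∣S─S∣≡0 : ∣ S ─ S ∣ ≡ 0
    ∣S─S∣≡0 = +-cancelʳ-≡ ∣ S ∣ ∣ S ─ S ∣ 0 (∣p─q∣+∣q∣≡∣p∣ S S id)

  1≤𝒢 : ∀ S → Connected G S → 1 ≤ ∣ S ∣ → ∣ S ∣ ≤ N → 1 ≤ 𝒢 S
  1≤𝒢 S conn 1≤∣S∣ ∣S∣≤N = subst (1 ≤_) (sym (𝒢-mex S)) (0∈⇒1≤mex (0∈optionValues S conn 1≤∣S∣ ∣S∣≤N))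

  𝒢≡1-singleton : ∀ S → 1 ≤ N → Connected G S → ∣ S ∣ ≡ 1 → 𝒢 S ≡ 1
  𝒢≡1-singleton S 1≤N conn ∣S∣≡1 = trans (𝒢-mex S) (0∈∧1∉⇒mex≡1 0∈ 1∉)
    where
    0∈ = 0∈optionValues S conn (≤-reflexive (sym ∣S∣≡1)) (subst (_≤ N) (sym ∣S∣≡1) 1≤N)
    1∉ : 1 ∉ₗ optionValues (I N) G S
    1∉ 1∈ with ∈-optionValues⁻ (I N) G 1∈
    ... | X , legal , 1≡𝒢 = contradiction (trans 1≡𝒢 (grundy-empty (I N) G (S ─ X) ∣S─X∣≡0)) λ ()
      where
      ∣S─X∣<∣S∣ = options-smaller (I N) G (I-positive N) (∈-options⁺ (I N) G legal)
      ∣S─X∣≡0 = n≤0⇒n≡0 (s≤s⁻¹ (subst (∣ S ─ X ∣ <_) ∣S∣≡1 ∣S─X∣<∣S∣))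

  2≤𝒢 : ∀ S → Connected G S → 2 ≤ ∣ S ∣ → ∣ S ∣ ≤ N → 2 ≤ 𝒢 S
  2≤𝒢 S conn 2≤∣S∣ ∣S∣≤N with non-cut-vertex G conn 2≤∣S∣
  ... | v , v∈ , conn-S-v =
    subst (2 ≤_) (sym (𝒢-mex S)) (0∈∧1∈⇒2≤mex (0∈optionValues S conn (≤-trans (n≤1+n 1) 2≤∣S∣) ∣S∣≤N) 1∈)
    where
    only-v : ∀ x → x ∈ S ─ (S - v) → x ≡ v
    only-v x x∈ = decidable-stable (x ≟ v) λ x≢v →
      x∈p─q⇒x∉q S (S - v) x∈ (x∈p∧x≢y⇒x∈p-y (p─q⊆p S (S - v) x∈) x≢v)
    ∣S-v∣+1≡∣S∣ = ∣p-x∣+1≡∣p∣ v∈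
    1≤∣S-v∣ = +-cancelʳ-≤ 1 1 ∣ S - v ∣ (subst (2 ≤_) (sym ∣S-v∣+1≡∣S∣) 2≤∣S∣)
    ∣S-v∣≤N = <⇒≤ (<-≤-trans (x∈p⇒∣p-x∣<∣p∣ v∈) ∣S∣≤N)
    legal : LegalRemoval (I N) G S (S - v)
    legal = p─q⊆p S ⁅ v ⁆ , T-I⁺ 1≤∣S-v∣ ∣S-v∣≤N , conn-S-v , Subsingleton⇒Connected G only-v
    ∣S─[S-v]∣≡1 : ∣ S ─ (S - v) ∣ ≡ 1
    ∣S─[S-v]∣≡1 = +-cancelʳ-≡ ∣ S - v ∣ _ 1
      (trans (∣p─q∣+∣q∣≡∣p∣ S (S - v) (p─q⊆p S ⁅ v ⁆)) (trans (sym ∣S-v∣+1≡∣S∣) (+-comm ∣ S - v ∣ 1)))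
    1∈ = subst (_∈ₗ optionValues (I N) G S)
      (𝒢≡1-singleton (S ─ (S - v)) (≤-trans 1≤∣S-v∣ ∣S-v∣≤N) (Subsingleton⇒Connected G only-v) ∣S─[S-v]∣≡1)
      (∈-optionValues⁺ (I N) G legal)

  𝒢≡0 : ∀ S → ∣ S ∣ ≡ suc N → 𝒢 S ≡ 0
  𝒢≡0 S ∣S∣≡1+N = trans (𝒢-mex S) (0∉⇒mex≡0 0∉)
    where
    0∉ : 0 ∉ₗ optionValues (I N) G S
    0∉ 0∈ with ∈-optionValues⁻ (I N) G 0∈
    ... | X , legal@(_ , _ , _ , conn) , 0≡𝒢 with remaining-size legal ∣S∣≡1+N
    ...   | 1≤∣S─X∣ , ∣S─X∣<1+N =
      contradiction (subst (1 ≤_) (sym 0≡𝒢) (1≤𝒢 (S ─ X) conn 1≤∣S─X∣ (s≤s⁻¹ ∣S─X∣<1+N))) λ ()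

  𝒢≢1 : ∀ S → Connected G S → 2 ≤ ∣ S ∣ → ∣ S ∣ ≤ suc N → 𝒢 S ≢ 1
  𝒢≢1 S conn 2≤∣S∣ ∣S∣≤1+N 𝒢≡1 with ∣ S ∣ ℕ.≟ suc N
  ... | yes ∣S∣≡1+N = contradiction (trans (sym 𝒢≡1) (𝒢≡0 S ∣S∣≡1+N)) λ ()
  ... | no  ∣S∣≢1+N = contradiction (subst (2 ≤_) 𝒢≡1 (2≤𝒢 S conn 2≤∣S∣ (s≤s⁻¹ (≤∧≢⇒< ∣S∣≤1+N ∣S∣≢1+N))))
                        λ { (s≤s ()) }

  𝒢≡1 : ∀ S → 1 ≤ N → Connected G S → ∣ S ∣ ≡ suc (suc N) → 𝒢 S ≡ 1
  𝒢≡1 S 1≤N conn ∣S∣≡2+N with non-cut-vertex G conn (subst (2 ≤_) (sym ∣S∣≡2+N) (s≤s (s≤s z≤n)))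
  ... | v , v∈ , conn-S-v = trans (𝒢-mex S) (0∈∧1∉⇒mex≡1 0∈ 1∉)
    where
    legal : LegalRemoval (I N) G S ⁅ v ⁆
    legal = x∈p⇒⁅x⁆⊆p v∈ , subst (T ∘ I N) (sym (∣⁅x⁆∣≡1 v)) (T-I⁺ ≤-refl 1≤N) ,
            Subsingleton⇒Connected G (λ x → x∈⁅y⁆⇒x≡y v) , conn-S-v
    ∣S-v∣≡1+N : ∣ S - v ∣ ≡ suc N
    ∣S-v∣≡1+N = +-cancelʳ-≡ 1 _ (suc N) (trans (∣p-x∣+1≡∣p∣ v∈) (trans ∣S∣≡2+N (+-comm 1 (suc N))))
    0∈ = subst (_∈ₗ optionValues (I N) G S) (𝒢≡0 (S - v) ∣S-v∣≡1+N) (∈-optionValues⁺ (I N) G legal)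
    1∉ : 1 ∉ₗ optionValues (I N) G S
    1∉ 1∈ with ∈-optionValues⁻ (I N) G 1∈
    ... | X , legal′@(_ , _ , _ , conn′) , 1≡𝒢 with remaining-size legal′ ∣S∣≡2+N
    ...   | 2≤∣S─X∣ , ∣S─X∣<2+N = 𝒢≢1 (S ─ X) conn′ 2≤∣S─X∣ (s≤s⁻¹ ∣S─X∣<2+N) (sym 1≡𝒢)

lemma5 : (N : ℕ) → 1 ≤ N → (n : ℕ) (G : Graph n) → Connected G ⊤ →
    ((n ≡ 0 ⊎ n ≡ 1) → grundy (I N) G ⊤ ≡ n)
    × (2 ≤ n → n ≤ N → 2 ≤ grundy (I N) G ⊤)
    × (n ≡ N + 1 → grundy (I N) G ⊤ ≡ 0)
    × (n ≡ N + 2 → grundy (I N) G ⊤ ≡ 1)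
lemma5 N 1≤N n G conn = empty-or-single , small , critical , critical+1
  where
  empty-or-single : (n ≡ 0 ⊎ n ≡ 1) → grundy (I N) G ⊤ ≡ n
  empty-or-single (inj₁ n≡0) = trans (grundy-empty (I N) G ⊤ (trans (∣⊤∣≡n n) n≡0)) (sym n≡0)
  empty-or-single (inj₂ n≡1) = trans (𝒢≡1-singleton N G ⊤ 1≤N conn (trans (∣⊤∣≡n n) n≡1)) (sym n≡1)
  small : 2 ≤ n → n ≤ N → 2 ≤ grundy (I N) G ⊤
  small 2≤n n≤N = 2≤𝒢 N G ⊤ conn (subst (2 ≤_) (sym (∣⊤∣≡n n)) 2≤n) (subst (_≤ N) (sym (∣⊤∣≡n n)) n≤N)
  critical : n ≡ N + 1 → grundy (I N) G ⊤ ≡ 0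
  critical n≡N+1 = 𝒢≡0 N G ⊤ (trans (∣⊤∣≡n n) (trans n≡N+1 (+-comm N 1)))
  critical+1 : n ≡ N + 2 → grundy (I N) G ⊤ ≡ 1
  critical+1 n≡N+2 = 𝒢≡1 N G ⊤ 1≤N conn (trans (∣⊤∣≡n n) (trans n≡N+2 (+-comm N 2)))
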